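{- Let $r\ge2$ and let $P$ be a collectable $r$-pattern. Let $\mathbb{RM}^{(r)}_n$ be an ordered $r$-matching chosen uniformly at random among all ordered $r$-matchings on $[rn]$. Then there is a constant $C>0$ depending only on $r$ such that, with probability tending to $1$ as $n\to\infty$, every $P$-clique contained in $\mathbb{RM}^{(r)}_n$ has size at most $Cn^{1/r}$.
   Context: An ordered $r$-matching on $[rn]$ is a set of $n$ pairwise disjoint $r$-element subsets of $[rn]$ covering $[rn]$. An $r$-pattern is an ordered $r$-matching with two edges, up to order-isomorphism. Two edges form pattern $P$ if with the induced order they are order-isomorphic to $P$; a $P$-clique is a matching in which every pair of edges forms $P$, and a $P$-clique in $M$ is a sub-matching of $M$ that is a $P$-clique. $P$ is collectable if $P$-cliques of every size $k\ge2$ exist. -}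

module Defs where

open import Data.Nat using (ℕ; zero; suc; _+_; _*_; _^_; _≤_; _<_)
open import Data.Fin using (Fin; zero; suc)
open import Data.Fin.Properties using (all?)
import Data.Fin.Properties as FinP
open import Data.Fin.Subset using (Subset; _∈_; ∣_∣)
open import Data.Vec using (Vec; []; _∷_; toList)
open import Data.List using (List; []; _∷_; [_]; map; concatMap; allFin; filter; length; mapMaybe)
open import Data.Maybe using (Maybe; just; nothing)
open import Data.Product using (Σ; _×_)
open import Data.Sum using (_⊎_)
open import Relation.Nullary using (¬_; Dec; does)
open import Relation.Binary.PropositionalEquality using (_≡_)
import Data.Nat as ℕ
open import Data.Bool using (if_then_else_)

-- Representation: an ordered r-matching on [rn] with n edges is encoded by a
-- labelling v : Vec (Fin n) (r * n) of the positions 0..rn-1 by edge labels,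
-- every label used exactly r times; the edge with label a is the set of
-- positions carrying label a.  (Each matching has exactly n! labellings.)

countLabel : {n : ℕ} → Fin n → List (Fin n) → ℕ
countLabel a xs = length (filter (λ x → x FinP.≟ a) xs)

IsMatching : (r : ℕ) {n m : ℕ} → Vec (Fin n) m → Set
IsMatching r {n} v = (a : Fin n) → countLabel a (toList v) ≡ r

isMatching? : (r : ℕ) {n m : ℕ} (v : Vec (Fin n) m) → Dec (IsMatching r v)
isMatching? r v = all? (λ a → countLabel a (toList v) ℕ.≟ r)

allVecs : (n m : ℕ) → List (Vec (Fin n) m)
allVecs n zero = [ [] ]
allVecs n (suc m) = concatMap (λ x → map (x ∷_) (allVecs n m)) (allFin n)

numMatchings : (r n : ℕ) → ℕ
numMatchings r n = length (filter (isMatching? r) (allVecs n (r * n)))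

-- An r-pattern is a 2-edge ordered r-matching on [2r], i.e. a labelling
-- P : Vec (Fin 2) (r * 2) with IsMatching r P.

swap2 : Fin 2 → Fin 2
swap2 zero = suc zero
swap2 (suc _) = zero

-- the order type of edges a and b of v: the sequence of positions in e_a ∪ e_b,
-- in increasing order, recording 0 for e_a and 1 for e_b
sel : {n : ℕ} → Fin n → Fin n → Fin n → Maybe (Fin 2)
sel a b x = if does (x FinP.≟ a) then just zero
            else (if does (x FinP.≟ b) then just (suc zero) else nothing)

pairWord : {n m : ℕ} → Vec (Fin n) m → Fin n → Fin n → List (Fin 2)
pairWord v a b = mapMaybe (sel a b) (toList v)

Forms : (r : ℕ) {n m : ℕ} → Vec (Fin 2) (r * 2) → Vec (Fin n) m → Fin n → Fin n → Set
Forms r P v a b = pairWord v a b ≡ toList P ⊎ pairWord v a b ≡ map swap2 (toList P)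

IsCliqueIn : (r : ℕ) {n m : ℕ} → Vec (Fin 2) (r * 2) → Vec (Fin n) m → Subset n → Set
IsCliqueIn r {n} P v S =
  (a b : Fin n) → a ∈ S → b ∈ S → ¬ (a ≡ b) → Forms r P v a b

Collectable : (r : ℕ) → Vec (Fin 2) (r * 2) → Set
Collectable r P = (k : ℕ) → 2 ≤ k →
  Σ (Vec (Fin k) (r * k)) λ v → IsMatching r v ×
    ((a b : Fin k) → ¬ (a ≡ b) → Forms r P v a b)

-- v contains a P-clique of size > C n^(1/r), i.e. size^r > C^r * n
Bad : (r C : ℕ) {n : ℕ} → Vec (Fin 2) (r * 2) → Vec (Fin n) (r * n) → Set
Bad r C {n} P v = Σ (Subset n) λ S → IsCliqueIn r P v S × (C ^ r * n < ∣ S ∣ ^ r)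

{-# OPTIONS --safe #-}
module Submission where

-- List the labels of an s-clique σ of v in order of first occurrence.  Every pair
-- a, b of them then has the same pair word in v, namely the orientation of P that starts with
-- its first edge.  Now overwrite the positions of v carrying labels of σ, from left to right, by
-- the labels σ(w₁), σ(w₂), … read off a "block matching" w on [rs] (r consecutive permutations
-- of [s]; there are (s!)^r of them).  This gives a matching again, and the pair words let one
-- recover v from the result: so (v, σ, w) ↦ (relabelled v, σ) is injective, and
--   #{(v, σ) : σ an s-clique of v} · (s!)^r ≤ #matchings · n^s.
-- Taking s least with s^r > 16^r n, the estimate s^s ≤ 8^s s! turns this into
-- #{v containing an s-clique} · (k + 1) ≤ #matchings as soon as n > k^r.

open import Data.Bool using (true; false; if_then_else_)
open import Data.Fin using (Fin; zero; suc)
import Data.Fin.Properties as Fin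
open import Data.Fin.Subset as Subset using (Subset; inside; outside; ∣_∣)
import Data.Fin.Subset.Properties as Subset
open import Data.List
  using (List; []; _∷_; [_]; _++_; map; length; filter; take; allFin; concatMap; mapMaybe; deduplicate;
         cartesianProduct; cartesianProductWith)
import Data.List.Properties as List
open import Data.List.Properties
  using (length-tabulate; length-map; length-++; length-++-sucʳ; filter-++; filter-none)
open import Data.List.Membership.Propositional using (_∈_; _∉_)
open import Data.List.Membership.Propositional.Properties
  using (∈-map⁺; ∈-map⁻; ∈-++⁺ˡ; ∈-++⁺ʳ; ∈-++⁻; ∈-∃++; ∈-filter⁺; ∈-filter⁻; ∈-deduplicate⁺; ∈-allFin;
         ∈-cartesianProductWith⁺; ∈-cartesianProductWith⁻; ∈-cartesianProduct⁺; ∈-cartesianProduct⁻)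
import Data.List.Membership.DecPropositional as DecMembership
open import Data.List.Relation.Unary.All using (All; []; _∷_)
import Data.List.Relation.Unary.All as All
import Data.List.Relation.Unary.All.Properties as All
open import Data.List.Relation.Unary.AllPairs using (AllPairs; []; _∷_)
import Data.List.Relation.Unary.AllPairs as AllPairs
import Data.List.Relation.Unary.AllPairs.Properties as AllPairs
open import Data.List.Relation.Unary.Any using (here; there)
import Data.List.Relation.Unary.Any as Any
open import Data.List.Relation.Unary.Unique.Propositional using (Unique)
import Data.List.Relation.Unary.Unique.Propositional.Properties as Unique
open import Data.Maybe using (just; nothing)
import Data.Maybe as Maybe
open import Data.Nat using (ℕ; zero; suc; _+_; _*_; _^_; _!; _≤_; _<_; _<?_; z≤n; s≤s; s≤s⁻¹; >-nonZero)
open import Data.Nat.Properties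
open import Algebra.Properties.CommutativeSemigroup +-commutativeSemigroup using (interchange; x∙yz≈y∙xz)
open import Data.Nat.Tactic.RingSolver using (solve-∀)
open import Data.Product using (Σ; ∃; _×_; _,_; proj₁; proj₂)
open import Data.Sum using (_⊎_; inj₁; inj₂; [_,_]′)
open import Data.Vec using (Vec; []; _∷_; toList)
import Data.Vec as Vec
import Data.Vec.Properties as Vec
open import Data.Vec.Membership.Propositional.Properties using (∈-lookup; ∈-toList⁺)
open import Data.Vec.Relation.Binary.Equality.Cast using (cast-is-id)
open import Function using (_∘_)
open import Relation.Binary.PropositionalEquality hiding ([_])
open import Relation.Nullary using (¬_; ¬?; Dec; yes; no; does; contradiction; _×-dec_)
import Relation.Nullary.Decidable as Dec
open import Relation.Unary using (Decidable)

open import Defs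

unique-⊆⇒length≤ : {A : Set} {xs ys : List A} → Unique xs → (∀ {x} → x ∈ xs → x ∈ ys) → length xs ≤ length ys
unique-⊆⇒length≤ {xs = []} _ _ = z≤n
unique-⊆⇒length≤ {xs = x ∷ xs} (x∉xs ∷ xs!) xs⊆ys with ∈-∃++ (xs⊆ys (here refl))
... | us , vs , refl = ≤-trans (s≤s (unique-⊆⇒length≤ xs! xs⊆us++vs)) (≤-reflexive (sym (length-++-sucʳ us x vs)))
  where
  xs⊆us++vs : ∀ {y} → y ∈ xs → y ∈ us ++ vs
  xs⊆us++vs y∈xs with ∈-++⁻ us (xs⊆ys (there y∈xs))
  ... | inj₁ y∈us = ∈-++⁺ˡ y∈us
  ... | inj₂ (here refl) = contradiction refl (All.lookup x∉xs y∈xs)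
  ... | inj₂ (there y∈vs) = ∈-++⁺ʳ us y∈vs

module _ {A B : Set} (f : A → B) where

  map-injectiveOn⁺ : {xs : List A} → Unique xs → (∀ {x y} → x ∈ xs → y ∈ xs → f x ≡ f y → x ≡ y) → Unique (map f xs)
  map-injectiveOn⁺ [] _ = []
  map-injectiveOn⁺ (x∉xs ∷ xs!) inj =
    All.map⁺ (All.tabulate λ y∈xs fx≡fy → All.lookup x∉xs y∈xs (inj (here refl) (there y∈xs) fx≡fy))
    ∷ map-injectiveOn⁺ xs! (λ x∈ y∈ → inj (there x∈) (there y∈))

  length-≤-injectiveOn : {xs : List A} {ys : List B} → Unique xs → (∀ {x} → x ∈ xs → f x ∈ ys) →
                         (∀ {x y} → x ∈ xs → y ∈ xs → f x ≡ f y → x ≡ y) → length xs ≤ length ys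
  length-≤-injectiveOn {xs} {ys} xs! maps-into inj =
    subst (_≤ length ys) (length-map f xs) (unique-⊆⇒length≤ (map-injectiveOn⁺ xs! inj) image⊆ys)
    where
    image⊆ys : ∀ {y} → y ∈ map f xs → y ∈ ys
    image⊆ys y∈ with ∈-map⁻ f y∈
    ... | _ , x∈xs , refl = maps-into x∈xs

length-cartesianProductWith : ∀ {A B C : Set} (f : A → B → C) xs ys →
                              length (cartesianProductWith f xs ys) ≡ length xs * length ys
length-cartesianProductWith f [] ys = refl
length-cartesianProductWith f (x ∷ xs) ys = begin
  length (map (f x) ys ++ cartesianProductWith f xs ys)         ≡⟨ length-++ (map (f x) ys) ⟩
  length (map (f x) ys) + length (cartesianProductWith f xs ys)
    ≡⟨ cong₂ _+_ (length-map (f x) ys) (length-cartesianProductWith f xs ys) ⟩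
  length ys + length xs * length ys ∎
  where open ≡-Reasoning

AllPairs-lookup : ∀ {A : Set} {R : A → A → Set} {xs : List A} {a b} →
                  AllPairs R xs → a ∈ xs → b ∈ xs → a ≢ b → R a b ⊎ R b a
AllPairs-lookup (_ ∷ _) (here refl) (here refl) a≢b = contradiction refl a≢b
AllPairs-lookup (ra ∷ _) (here refl) (there b∈) _ = inj₁ (All.lookup ra b∈)
AllPairs-lookup (rb ∷ _) (there a∈) (here refl) _ = inj₂ (All.lookup rb a∈)
AllPairs-lookup (_ ∷ rs) (there a∈) (there b∈) a≢b = AllPairs-lookup rs a∈ b∈ a≢b

AllPairs-mapWithAll : {A : Set} {P : A → Set} {R S : A → A → Set} → (∀ {a b} → P a → P b → R a b → S a b) →
                      ∀ {xs} → All P xs → AllPairs R xs → AllPairs S xs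
AllPairs-mapWithAll f [] [] = []
AllPairs-mapWithAll f (pa ∷ ps) (ra ∷ rs) =
  All.zipWith (λ (pb , r) → f pa pb r) (ps , ra) ∷ AllPairs-mapWithAll f ps rs

take-vec : ∀ {A : Set} s (xs : List A) → s ≤ length xs → Σ (Vec A s) λ σ → toList σ ≡ take s xs
take-vec zero xs _ = [] , refl
take-vec (suc s) (x ∷ xs) (s≤s s≤) with take-vec s xs s≤
... | σ , σ≡ = x ∷ σ , cong (x ∷_) σ≡

tuples : {A : Set} → List A → (m : ℕ) → List (Vec A m)
tuples xs zero = [ [] ]
tuples xs (suc m) = cartesianProductWith _∷_ xs (tuples xs m)

module _ {A : Set} where

  length-tuples : ∀ (xs : List A) m → length (tuples xs m) ≡ length xs ^ m
  length-tuples xs zero = refl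
  length-tuples xs (suc m) =
    trans (length-cartesianProductWith _∷_ xs (tuples xs m)) (cong (length xs *_) (length-tuples xs m))

  tuples⁺ : ∀ {xs : List A} m → Unique xs → Unique (tuples xs m)
  tuples⁺ zero _ = [] ∷ []
  tuples⁺ (suc m) xs! = Unique.cartesianProductWith⁺ _∷_ Vec.∷-injective xs! (tuples⁺ m xs!)

  ∈-tuples : ∀ {xs : List A} {m} → (∀ x → x ∈ xs) → (v : Vec A m) → v ∈ tuples xs m
  ∈-tuples _ [] = here refl
  ∈-tuples all∈ (x ∷ v) = ∈-cartesianProductWith⁺ _∷_ (all∈ x) (∈-tuples all∈ v)

allVecs≡tuples : ∀ n m → allVecs n m ≡ tuples (allFin n) m
allVecs≡tuples n zero = refl
allVecs≡tuples n (suc m) =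
  trans (concatMap≡cartesianProductWith (allFin n)) (cong (cartesianProductWith _∷_ (allFin n)) (allVecs≡tuples n m))
  where
  concatMap≡cartesianProductWith : ∀ xs →
    concatMap (λ x → map (x ∷_) (allVecs n m)) xs ≡ cartesianProductWith _∷_ xs (allVecs n m)
  concatMap≡cartesianProductWith [] = refl
  concatMap≡cartesianProductWith (x ∷ xs) = cong (map (x ∷_) (allVecs n m) ++_) (concatMap≡cartesianProductWith xs)

allVecs⁺ : ∀ n m → Unique (allVecs n m)
allVecs⁺ n m = subst Unique (sym (allVecs≡tuples n m)) (tuples⁺ m (Unique.allFin⁺ n))

∈-allVecs : ∀ {n m} (v : Vec (Fin n) m) → v ∈ allVecs n m
∈-allVecs {n} {m} v = subst (v ∈_) (sym (allVecs≡tuples n m)) (∈-tuples ∈-allFin v)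

length-allVecs : ∀ n m → length (allVecs n m) ≡ n ^ m
length-allVecs n m = begin
  length (allVecs n m)           ≡⟨ cong length (allVecs≡tuples n m) ⟩
  length (tuples (allFin n) m)   ≡⟨ length-tuples (allFin n) m ⟩
  length (allFin n) ^ m          ≡⟨ cong (_^ m) (length-tabulate {n = n} (λ i → i)) ⟩
  n ^ m ∎
  where open ≡-Reasoning

𝟙 : {P : Set} → Dec P → ℕ
𝟙 d = if does d then 1 else 0

𝟙-yes : {P : Set} (d : Dec P) → P → 𝟙 d ≡ 1
𝟙-yes (yes _) _ = refl
𝟙-yes (no ¬p) p = contradiction p ¬p

𝟙-no : {P : Set} (d : Dec P) → ¬ P → 𝟙 d ≡ 0
𝟙-no (yes p) ¬p = contradiction p ¬p
𝟙-no (no _) _ = refl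

𝟙-⇔ : {P Q : Set} → (P → Q) → (Q → P) → (d : Dec P) (e : Dec Q) → 𝟙 d ≡ 𝟙 e
𝟙-⇔ P⇒Q _ (yes p) e = sym (𝟙-yes e (P⇒Q p))
𝟙-⇔ _ Q⇒P (no ¬p) e = sym (𝟙-no e (¬p ∘ Q⇒P))

𝟙-⊎ : {P Q R : Set} → ¬ (P × Q) → (R → P ⊎ Q) → (P ⊎ Q → R) → (r : Dec R) (p : Dec P) (q : Dec Q) →
      𝟙 r ≡ 𝟙 p + 𝟙 q
𝟙-⊎ _ _ P⊎Q⇒R r (yes p) (no _) = 𝟙-yes r (P⊎Q⇒R (inj₁ p))
𝟙-⊎ _ _ P⊎Q⇒R r (no _) (yes q) = 𝟙-yes r (P⊎Q⇒R (inj₂ q))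
𝟙-⊎ _ R⇒P⊎Q _ r (no ¬p) (no ¬q) = 𝟙-no r ([ ¬p , ¬q ]′ ∘ R⇒P⊎Q)
𝟙-⊎ ¬P×Q _ _ _ (yes p) (yes q) = contradiction (p , q) ¬P×Q

length-filter-∷ : ∀ {A : Set} {P : A → Set} (P? : Decidable P) x xs →
                  length (filter P? (x ∷ xs)) ≡ 𝟙 (P? x) + length (filter P? xs)
length-filter-∷ P? x xs with does (P? x)
... | true = refl
... | false = refl

δ : ∀ {n} → Fin n → Fin n → ℕ
δ x a = 𝟙 (x Fin.≟ a)

countLabel-∷ : ∀ {n} (a x : Fin n) xs → countLabel a (x ∷ xs) ≡ δ x a + countLabel a xs
countLabel-∷ a = length-filter-∷ (Fin._≟ a)

countLabel-∷-cong : ∀ {n} (a x : Fin n) {xs ys} → countLabel a xs ≡ countLabel a ys →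
                    countLabel a (x ∷ xs) ≡ countLabel a (x ∷ ys)
countLabel-∷-cong a x {xs} {ys} eq =
  trans (countLabel-∷ a x xs) (trans (cong (δ x a +_) eq) (sym (countLabel-∷ a x ys)))

countLabel-++ : ∀ {n} (a : Fin n) xs ys → countLabel a (xs ++ ys) ≡ countLabel a xs + countLabel a ys
countLabel-++ a xs ys = trans (cong length (filter-++ (Fin._≟ a) xs ys)) (length-++ (filter (Fin._≟ a) xs))

countLabel-∉ : ∀ {n} {a : Fin n} {xs} → a ∉ xs → countLabel a xs ≡ 0
countLabel-∉ a∉xs = cong length (filter-none (Fin._≟ _) (All.tabulate λ x∈xs x≡a → a∉xs (subst (_∈ _) x≡a x∈xs)))

infix 4 _∈?_
_∈?_ : ∀ {n} (x : Fin n) (xs : List (Fin n)) → Dec (x ∈ xs)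
_∈?_ = DecMembership._∈?_ Fin._≟_

countLabel>0⇒∈ : ∀ {n} {a : Fin n} {xs} → 0 < countLabel a xs → a ∈ xs
countLabel>0⇒∈ {a = a} {xs} count>0 with a ∈? xs
... | yes a∈xs = a∈xs
... | no a∉xs = contradiction (countLabel-∉ a∉xs) (>⇒≢ count>0)

countLabel-map : ∀ {n m} (f : Fin n → Fin m) → (∀ {x y} → f x ≡ f y → x ≡ y) →
                 ∀ a xs → countLabel (f a) (map f xs) ≡ countLabel a xs
countLabel-map f f-inj a [] = refl
countLabel-map f f-inj a (x ∷ xs) = begin
  countLabel (f a) (f x ∷ map f xs)           ≡⟨ countLabel-∷ (f a) (f x) (map f xs) ⟩
  δ (f x) (f a) + countLabel (f a) (map f xs)
    ≡⟨ cong₂ _+_ (𝟙-⇔ f-inj (cong f) (f x Fin.≟ f a) (x Fin.≟ a)) (countLabel-map f f-inj a xs) ⟩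
  δ x a + countLabel a xs                     ≡⟨ countLabel-∷ a x xs ⟨
  countLabel a (x ∷ xs) ∎
  where open ≡-Reasoning

countLabel-insertAt : ∀ {n m} (a x : Fin n) (xs : Vec (Fin n) m) i →
                      countLabel a (toList (Vec.insertAt xs i x)) ≡ δ x a + countLabel a (toList xs)
countLabel-insertAt a x xs zero = countLabel-∷ a x (toList xs)
countLabel-insertAt a x (y ∷ xs) (suc i) = begin
  countLabel a (y ∷ toList (Vec.insertAt xs i x))     ≡⟨ countLabel-∷ a y _ ⟩
  δ y a + countLabel a (toList (Vec.insertAt xs i x)) ≡⟨ cong (δ y a +_) (countLabel-insertAt a x xs i) ⟩
  δ y a + (δ x a + countLabel a (toList xs))          ≡⟨ x∙yz≈y∙xz (δ y a) (δ x a) _ ⟩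
  δ x a + (δ y a + countLabel a (toList xs))          ≡⟨ cong (δ x a +_) (countLabel-∷ a y (toList xs)) ⟨
  δ x a + countLabel a (y ∷ toList xs) ∎
  where open ≡-Reasoning

IsMatching-++ : ∀ {r₁ r₂ n m₁ m₂} (xs : Vec (Fin n) m₁) (ys : Vec (Fin n) m₂) →
                IsMatching r₁ xs → IsMatching r₂ ys → IsMatching (r₁ + r₂) (xs Vec.++ ys)
IsMatching-++ {r₁} {r₂} xs ys xs-match ys-match a = begin
  countLabel a (toList (xs Vec.++ ys))                ≡⟨ cong (countLabel a) (Vec.toList-++ xs ys) ⟩
  countLabel a (toList xs ++ toList ys)               ≡⟨ countLabel-++ a (toList xs) (toList ys) ⟩
  countLabel a (toList xs) + countLabel a (toList ys) ≡⟨ cong₂ _+_ (xs-match a) (ys-match a) ⟩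
  r₁ + r₂ ∎
  where open ≡-Reasoning

labelsIn : ∀ {n} → List (Fin n) → List (Fin n) → ℕ
labelsIn l xs = length (filter (_∈? l) xs)

labelsIn-∷ : ∀ {n} {a : Fin n} {l} xs → a ∉ l → labelsIn (a ∷ l) xs ≡ countLabel a xs + labelsIn l xs
labelsIn-∷ [] _ = refl
labelsIn-∷ {a = a} {l} (x ∷ xs) a∉l = begin
  labelsIn (a ∷ l) (x ∷ xs)                                ≡⟨ length-filter-∷ (_∈? a ∷ l) x xs ⟩
  𝟙 (x ∈? a ∷ l) + labelsIn (a ∷ l) xs                     ≡⟨ cong₂ _+_ indicator (labelsIn-∷ xs a∉l) ⟩
  (δ x a + 𝟙 (x ∈? l)) + (countLabel a xs + labelsIn l xs) ≡⟨ interchange (δ x a) _ _ _ ⟩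
  (δ x a + countLabel a xs) + (𝟙 (x ∈? l) + labelsIn l xs)
    ≡⟨ cong₂ _+_ (countLabel-∷ a x xs) (length-filter-∷ (_∈? l) x xs) ⟨
  countLabel a (x ∷ xs) + labelsIn l (x ∷ xs) ∎
  where
  open ≡-Reasoning
  indicator : 𝟙 (x ∈? a ∷ l) ≡ δ x a + 𝟙 (x ∈? l)
  indicator = 𝟙-⊎ (λ { (refl , x∈l) → a∉l x∈l }) Any.toSum Any.fromSum (x ∈? a ∷ l) (x Fin.≟ a) (x ∈? l)

labelsIn-matching : ∀ {n r} (l : List (Fin n)) xs → Unique l → (∀ a → countLabel a xs ≡ r) →
                    labelsIn l xs ≡ length l * r
labelsIn-matching [] xs _ _ = cong length (filter-none (_∈? []) {xs} (All.tabulate λ _ ()))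
labelsIn-matching (a ∷ l) xs (a∉l ∷ l!) counts =
  trans (labelsIn-∷ xs (λ a∈l → All.lookup a∉l a∈l refl)) (cong₂ _+_ (counts a) (labelsIn-matching l xs l! counts))

-- Permutations and block matchings

insertZero : ∀ {s m} → Vec (Fin s) m → Fin (suc m) → Vec (Fin (suc s)) (suc m)
insertZero p i = Vec.insertAt (Vec.map suc p) i zero

permutations : (s : ℕ) → List (Vec (Fin s) s)
permutations zero = [ [] ]
permutations (suc s) = cartesianProductWith insertZero (permutations s) (allFin (suc s))

insertZero-injective : ∀ {s m} (p q : Vec (Fin s) m) (i j : Fin (suc m)) →
                       insertZero p i ≡ insertZero q j → p ≡ q × i ≡ j
insertZero-injective p q zero zero eq = map-suc-injective p q (Vec.∷-injectiveʳ eq) , refl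
  where
  map-suc-injective : ∀ {s m} (p q : Vec (Fin s) m) → Vec.map (Fin.suc {n = s}) p ≡ Vec.map suc q → p ≡ q
  map-suc-injective [] [] _ = refl
  map-suc-injective (x ∷ p) (y ∷ q) eq =
    cong₂ _∷_ (Fin.suc-injective {i = x} {j = y} (Vec.∷-injectiveˡ eq)) (map-suc-injective p q (Vec.∷-injectiveʳ eq))
insertZero-injective p (y ∷ q) zero (suc j) ()
insertZero-injective (x ∷ p) q (suc i) zero ()
insertZero-injective (x ∷ p) (y ∷ q) (suc i) (suc j) eq with insertZero-injective p q i j (Vec.∷-injectiveʳ eq)
... | refl , refl = cong (_∷ p) (Fin.suc-injective {i = x} {j = y} (Vec.∷-injectiveˡ eq)) , refl

length-permutations : ∀ s → length (permutations s) ≡ s !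
length-permutations zero = refl
length-permutations (suc s) = begin
  length (permutations (suc s))
    ≡⟨ length-cartesianProductWith insertZero (permutations s) (allFin (suc s)) ⟩
  length (permutations s) * length (allFin (suc s))
    ≡⟨ cong₂ _*_ (length-permutations s) (length-tabulate {n = suc s} (λ i → i)) ⟩
  s ! * suc s ≡⟨ *-comm (s !) (suc s) ⟩
  suc s ! ∎
  where open ≡-Reasoning

permutations⁺ : ∀ s → Unique (permutations s)
permutations⁺ zero = [] ∷ []
permutations⁺ (suc s) = Unique.cartesianProductWith⁺ insertZero (λ {p} {q} {i} {j} → insertZero-injective p q i j)
  (permutations⁺ s) (Unique.allFin⁺ (suc s))

permutation⇒isMatching : ∀ {s} {p : Vec (Fin s) s} → p ∈ permutations s → IsMatching 1 p
permutation⇒isMatching {suc s} p∈ with ∈-cartesianProductWith⁻ insertZero (permutations s) (allFin (suc s)) p∈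
... | q , i , q∈ , _ , refl = λ a → trans (countLabel-insertAt a zero (Vec.map suc q) i) (count a)
  where
  count : ∀ a → δ zero a + countLabel a (toList (Vec.map suc q)) ≡ 1
  count zero = cong suc (trans (cong (countLabel zero) (Vec.toList-map suc q)) (countLabel-∉ zero∉))
    where
    zero∉ : zero ∉ map suc (toList q)
    zero∉ z∈ with ∈-map⁻ suc z∈
    ... | _ , _ , ()
  count (suc b) = trans (cong (countLabel (suc b)) (Vec.toList-map suc q))
                        (trans (countLabel-map suc Fin.suc-injective b (toList q)) (permutation⇒isMatching q∈ b))

blockMatchings : (r s : ℕ) → List (Vec (Fin s) (r * s))
blockMatchings r s = map Vec.concat (tuples (permutations s) r)

concat-injective : ∀ {A : Set} {r s} (xss yss : Vec (Vec A s) r) → Vec.concat xss ≡ Vec.concat yss → xss ≡ yss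
concat-injective [] [] _ = refl
concat-injective (xs ∷ xss) (ys ∷ yss) eq =
  cong₂ _∷_ (Vec.++-injectiveˡ xs ys eq) (concat-injective xss yss (Vec.++-injectiveʳ xs ys eq))

length-blockMatchings : ∀ r s → length (blockMatchings r s) ≡ (s !) ^ r
length-blockMatchings r s = begin
  length (blockMatchings r s)           ≡⟨ length-map Vec.concat (tuples (permutations s) r) ⟩
  length (tuples (permutations s) r)    ≡⟨ length-tuples (permutations s) r ⟩
  length (permutations s) ^ r           ≡⟨ cong (_^ r) (length-permutations s) ⟩
  (s !) ^ r ∎
  where open ≡-Reasoning

blockMatchings⁺ : ∀ r s → Unique (blockMatchings r s)
blockMatchings⁺ r s = Unique.map⁺ (concat-injective _ _) (tuples⁺ r (permutations⁺ s))

blockMatching⇒isMatching : ∀ r {s} {w : Vec (Fin s) (r * s)} → w ∈ blockMatchings r s → IsMatching r w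
blockMatching⇒isMatching r {s} w∈ with ∈-map⁻ Vec.concat w∈
... | blocks , blocks∈ , refl = concat-isMatching r blocks blocks∈
  where
  concat-isMatching : ∀ r (blocks : Vec (Vec (Fin s) s) r) → blocks ∈ tuples (permutations s) r →
                      IsMatching r (Vec.concat blocks)
  concat-isMatching zero [] _ _ = refl
  concat-isMatching (suc r) (p ∷ blocks) p∷blocks∈
    with ∈-cartesianProductWith⁻ _∷_ (permutations s) (tuples (permutations s) r) p∷blocks∈
  ... | _ , _ , p∈ , blocks∈ , refl =
    IsMatching-++ p (Vec.concat blocks) (permutation⇒isMatching p∈) (concat-isMatching r blocks blocks∈)

pairWordˡ : ∀ {n} → List (Fin n) → Fin n → Fin n → List (Fin 2)
pairWordˡ xs a b = mapMaybe (sel a b) xs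

module _ {n : ℕ} where

  sel-first : ∀ (a b : Fin n) → sel a b a ≡ just zero
  sel-first a b with a Fin.≟ a
  ... | yes _ = refl
  ... | no a≢a = contradiction refl a≢a

  sel-second : ∀ {a b : Fin n} → a ≢ b → sel a b b ≡ just (suc zero)
  sel-second {a} {b} a≢b with b Fin.≟ a | b Fin.≟ b
  ... | yes b≡a | _ = contradiction (sym b≡a) a≢b
  ... | no _ | yes _ = refl
  ... | no _ | no b≢b = contradiction refl b≢b

  sel-other : ∀ {a b x : Fin n} → x ≢ a → x ≢ b → sel a b x ≡ nothing
  sel-other {a} {b} {x} x≢a x≢b with x Fin.≟ a | x Fin.≟ b
  ... | yes x≡a | _ = contradiction x≡a x≢a
  ... | no _ | yes x≡b = contradiction x≡b x≢b
  ... | no _ | no _ = refl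

  map-swap2-sel : ∀ {a b : Fin n} → a ≢ b → ∀ x → Maybe.map swap2 (sel b a x) ≡ sel a b x
  map-swap2-sel {a} {b} a≢b x with x Fin.≟ a | x Fin.≟ b
  ... | yes refl | yes refl = contradiction refl a≢b
  ... | yes refl | no _ = refl
  ... | no _ | yes refl = refl
  ... | no _ | no _ = refl

  pairWordˡ-first : ∀ (a b : Fin n) xs → pairWordˡ (a ∷ xs) a b ≡ zero ∷ pairWordˡ xs a b
  pairWordˡ-first a b xs rewrite sel-first a b = refl

  pairWordˡ-second : ∀ {a b : Fin n} xs → a ≢ b → pairWordˡ (b ∷ xs) a b ≡ suc zero ∷ pairWordˡ xs a b
  pairWordˡ-second xs a≢b rewrite sel-second a≢b = refl

  pairWordˡ-other : ∀ {a b x : Fin n} xs → x ≢ a → x ≢ b → pairWordˡ (x ∷ xs) a b ≡ pairWordˡ xs a b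
  pairWordˡ-other xs x≢a x≢b rewrite sel-other x≢a x≢b = refl

  pairWordˡ-swap : ∀ {a b : Fin n} → a ≢ b → ∀ xs → pairWordˡ xs a b ≡ map swap2 (pairWordˡ xs b a)
  pairWordˡ-swap a≢b [] = refl
  pairWordˡ-swap {a} {b} a≢b (x ∷ xs) with sel b a x | sel a b x | map-swap2-sel a≢b x
  ... | just z | .(just (swap2 z)) | refl = cong (swap2 z ∷_) (pairWordˡ-swap a≢b xs)
  ... | nothing | .nothing | refl = pairWordˡ-swap a≢b xs

  pairWordˡ-∷-cancel : ∀ (a b x : Fin n) xs ys →
                       pairWordˡ (x ∷ xs) a b ≡ pairWordˡ (x ∷ ys) a b → pairWordˡ xs a b ≡ pairWordˡ ys a b
  pairWordˡ-∷-cancel a b x xs ys eq with sel a b x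
  ... | just _ = List.∷-injectiveʳ eq
  ... | nothing = eq

normalise : List (Fin 2) → List (Fin 2)
normalise [] = []
normalise (zero ∷ t) = zero ∷ t
normalise (suc z ∷ t) = map swap2 (suc z ∷ t)

oriented≡normalise : ∀ {w t} p → w ≡ p ⊎ w ≡ map swap2 p → w ≡ zero ∷ t → w ≡ normalise p
oriented≡normalise (zero ∷ p) (inj₁ w≡p) _ = w≡p
oriented≡normalise (suc _ ∷ p) (inj₂ w≡p̃) _ = w≡p̃
oriented≡normalise (zero ∷ p) (inj₂ refl) ()
oriented≡normalise (suc _ ∷ p) (inj₁ refl) ()
oriented≡normalise [] (inj₁ refl) ()
oriented≡normalise [] (inj₂ refl) ()

FirstBefore : ∀ {n} → List (Fin n) → Fin n → Fin n → Set
FirstBefore xs a b = a ≢ b × ∃ λ t → pairWordˡ xs a b ≡ zero ∷ t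

deduplicate-firstBefore : ∀ {n} (xs : List (Fin n)) → AllPairs (FirstBefore xs) (deduplicate Fin._≟_ xs)
deduplicate-firstBefore [] = []
deduplicate-firstBefore (x ∷ xs) =
  All.tabulate (λ b∈ → x≢ b∈ , pairWordˡ xs x _ , pairWordˡ-first x _ xs)
  ∷ AllPairs-mapWithAll extend (All.tabulate x≢) (AllPairs.filter⁺ _ (deduplicate-firstBefore xs))
  where
  x≢ : ∀ {b} → b ∈ filter (λ y → ¬? (x Fin.≟ y)) (deduplicate Fin._≟_ xs) → x ≢ b
  x≢ b∈ = proj₂ (∈-filter⁻ (λ y → ¬? (x Fin.≟ y)) {xs = deduplicate Fin._≟_ xs} b∈)
  extend : ∀ {a b} → x ≢ a → x ≢ b → FirstBefore xs a b → FirstBefore (x ∷ xs) a b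
  extend x≢a x≢b (a≢b , t , eq) = a≢b , t , trans (pairWordˡ-other xs x≢a x≢b) eq

SamePairWordsOn : ∀ {n} → List (Fin n) → List (Fin n) → List (Fin n) → Set
SamePairWordsOn l xs ys = ∀ {a b} → a ∈ l → b ∈ l → a ≢ b → pairWordˡ xs a b ≡ pairWordˡ ys a b

samePairWordsOn-∷⁻ : ∀ {n} {l : List (Fin n)} x xs ys → SamePairWordsOn l (x ∷ xs) (x ∷ ys) → SamePairWordsOn l xs ys
samePairWordsOn-∷⁻ x xs ys same {a} {b} a∈ b∈ a≢b = pairWordˡ-∷-cancel a b x xs ys (same a∈ b∈ a≢b)

record OrderedClique r {n m s} (P : Vec (Fin 2) (r * 2)) (v : Vec (Fin n) m) (σ : Vec (Fin n) s) : Set where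
  constructor orderedClique
  field
    pairs : AllPairs (λ a b → a ≢ b × pairWord v a b ≡ normalise (toList P)) (toList σ)

orderedClique? : ∀ r {n m s} (P : Vec (Fin 2) (r * 2)) (v : Vec (Fin n) m) (σ : Vec (Fin n) s) →
                 Dec (OrderedClique r P v σ)
orderedClique? r P v σ = Dec.map′ orderedClique OrderedClique.pairs
  (AllPairs.allPairs? (λ a b → ¬? (a Fin.≟ b) ×-dec List.≡-dec Fin._≟_ (pairWord v a b) (normalise (toList P)))
                      (toList σ))

orderedClique⇒unique : ∀ r {n m s} {P : Vec (Fin 2) (r * 2)} {v : Vec (Fin n) m} {σ : Vec (Fin n) s} →
                       OrderedClique r P v σ → Unique (toList σ)
orderedClique⇒unique r (orderedClique pairs) = AllPairs.map proj₁ pairs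

orderedClique⇒samePairWords : ∀ r {n m s} {P : Vec (Fin 2) (r * 2)} {v₁ v₂ : Vec (Fin n) m} {σ : Vec (Fin n) s} →
  OrderedClique r P v₁ σ → OrderedClique r P v₂ σ → SamePairWordsOn (toList σ) (toList v₁) (toList v₂)
orderedClique⇒samePairWords r {v₁ = v₁} {v₂} (orderedClique σ₁) (orderedClique σ₂) a∈ b∈ a≢b
  with AllPairs-lookup (AllPairs.zip (σ₁ , σ₂)) a∈ b∈ a≢b
... | inj₁ ((_ , eq₁) , (_ , eq₂)) = trans eq₁ (sym eq₂)
... | inj₂ ((_ , eq₁) , (_ , eq₂)) = begin
  pairWord v₁ _ _             ≡⟨ pairWordˡ-swap a≢b (toList v₁) ⟩
  map swap2 (pairWord v₁ _ _) ≡⟨ cong (map swap2) (trans eq₁ (sym eq₂)) ⟩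
  map swap2 (pairWord v₂ _ _) ≡⟨ pairWordˡ-swap a≢b (toList v₂) ⟨
  pairWord v₂ _ _ ∎
  where open ≡-Reasoning

elements : ∀ {n} → Subset n → List (Fin n)
elements [] = []
elements (inside ∷ p) = zero ∷ map suc (elements p)
elements (outside ∷ p) = map suc (elements p)

length-elements : ∀ {n} (p : Subset n) → length (elements p) ≡ ∣ p ∣
length-elements [] = refl
length-elements (inside ∷ p) = cong suc (trans (length-map suc (elements p)) (length-elements p))
length-elements (outside ∷ p) = trans (length-map suc (elements p)) (length-elements p)

elements⁺ : ∀ {n} (p : Subset n) → Unique (elements p)
elements⁺ [] = []
elements⁺ (inside ∷ p) = All.map⁺ (All.tabulate λ _ ()) ∷ Unique.map⁺ Fin.suc-injective (elements⁺ p)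
elements⁺ (outside ∷ p) = Unique.map⁺ Fin.suc-injective (elements⁺ p)

∈-elements⁻ : ∀ {n} {a : Fin n} (p : Subset n) → a ∈ elements p → a Subset.∈ p
∈-elements⁻ (inside ∷ p) (here refl) = Vec.here
∈-elements⁻ (inside ∷ p) (there a∈) with ∈-map⁻ suc a∈
... | b , b∈ , refl = Vec.there (∈-elements⁻ p b∈)
∈-elements⁻ (outside ∷ p) a∈ with ∈-map⁻ suc a∈
... | b , b∈ , refl = Vec.there (∈-elements⁻ p b∈)

clique⇒orderedClique : ∀ r {n m} (P : Vec (Fin 2) (r * 2)) (v : Vec (Fin n) m) (S : Subset n) →
  (∀ a → a ∈ toList v) → IsCliqueIn r P v S → ∀ s → s ≤ ∣ S ∣ → Σ (Vec (Fin n) s) (OrderedClique r P v)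
clique⇒orderedClique r P v S occurs clique s s≤∣S∣ =
  proj₁ prefix , orderedClique (subst (AllPairs _) (sym (proj₂ prefix)) (AllPairs.take⁺ s oriented-pairs))
  where
  firstOccurrences : List (Fin _)
  firstOccurrences = filter (Subset._∈? S) (deduplicate Fin._≟_ (toList v))
  ∈-firstOccurrences⁻ : ∀ {a} → a ∈ firstOccurrences → a Subset.∈ S
  ∈-firstOccurrences⁻ = proj₂ ∘ ∈-filter⁻ (Subset._∈? S) {xs = deduplicate Fin._≟_ (toList v)}
  elements⊆ : ∀ {a} → a ∈ elements S → a ∈ firstOccurrences
  elements⊆ a∈ = ∈-filter⁺ (Subset._∈? S) (∈-deduplicate⁺ Fin._≟_ (occurs _)) (∈-elements⁻ S a∈)
  s≤length : s ≤ length firstOccurrences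
  s≤length = ≤-trans s≤∣S∣
    (subst (_≤ length firstOccurrences) (length-elements S) (unique-⊆⇒length≤ (elements⁺ S) elements⊆))
  orient : ∀ {a b} → a Subset.∈ S → b Subset.∈ S → FirstBefore (toList v) a b →
           a ≢ b × pairWord v a b ≡ normalise (toList P)
  orient a∈S b∈S (a≢b , _ , eq) = a≢b , oriented≡normalise (toList P) (clique _ _ a∈S b∈S a≢b) eq
  oriented-pairs : AllPairs (λ a b → a ≢ b × pairWord v a b ≡ normalise (toList P)) firstOccurrences
  oriented-pairs = AllPairs-mapWithAll orient (All.tabulate ∈-firstOccurrences⁻)
                                       (AllPairs.filter⁺ _ (deduplicate-firstBefore (toList v)))
  prefix : Σ (Vec (Fin _) s) λ σ → toList σ ≡ take s firstOccurrences
  prefix = take-vec s firstOccurrences s≤length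

-- Relabelling the positions of a clique

module _ {A : Set} where

  lookup-∈ : ∀ {s} (σ : Vec A s) i → Vec.lookup σ i ∈ toList σ
  lookup-∈ σ i = ∈-toList⁺ (∈-lookup i σ)

  ∈⇒lookup : ∀ {s} (σ : Vec A s) {x} → x ∈ toList σ → ∃ λ i → Vec.lookup σ i ≡ x
  ∈⇒lookup (_ ∷ _) (here refl) = zero , refl
  ∈⇒lookup (_ ∷ σ) (there x∈) with ∈⇒lookup σ x∈
  ... | i , eq = suc i , eq

  lookup-injective : ∀ {s} (σ : Vec A s) → Unique (toList σ) → ∀ i j → Vec.lookup σ i ≡ Vec.lookup σ j → i ≡ j
  lookup-injective (_ ∷ _) _ zero zero _ = refl
  lookup-injective (_ ∷ σ) (x∉σ ∷ _) zero (suc j) eq = contradiction eq (All.lookup x∉σ (lookup-∈ σ j))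
  lookup-injective (_ ∷ σ) (x∉σ ∷ _) (suc i) zero eq = contradiction (sym eq) (All.lookup x∉σ (lookup-∈ σ i))
  lookup-injective (_ ∷ σ) (_ ∷ σ!) (suc i) (suc j) eq = cong suc (lookup-injective σ σ! i j eq)

module Relabel {n s : ℕ} (σ : Vec (Fin n) s) where

  -- The clause for an exhausted w is junk: relabel is only used when w fits xs.
  relabel : ∀ {m} → Vec (Fin n) m → List (Fin s) → Vec (Fin n) m
  relabel [] _ = []
  relabel (x ∷ xs) w with x ∈? toList σ | w
  ... | yes _ | i ∷ w′ = Vec.lookup σ i ∷ relabel xs w′
  ... | yes _ | []     = x ∷ relabel xs []
  ... | no _  | w′     = x ∷ relabel xs w′

  Fits : ∀ {m} → Vec (Fin n) m → List (Fin s) → Set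
  Fits xs w = length w ≡ labelsIn (toList σ) (toList xs)

  δ-∉ : ∀ {x b} → x ∈ toList σ → b ∉ toList σ → δ x b ≡ 0
  δ-∉ {x} {b} x∈σ b∉σ = 𝟙-no (x Fin.≟ b) λ { refl → b∉σ x∈σ }

  relabel-countLabel-outside : ∀ {m} {b} (xs : Vec (Fin n) m) w → b ∉ toList σ → Fits xs w →
                               countLabel b (toList (relabel xs w)) ≡ countLabel b (toList xs)
  relabel-countLabel-outside [] _ _ _ = refl
  relabel-countLabel-outside {b = b} (x ∷ xs) w b∉σ fits with x ∈? toList σ | w
  ... | yes x∈σ | i ∷ w′ = begin
    countLabel b (Vec.lookup σ i ∷ toList (relabel xs w′))
      ≡⟨ countLabel-∷ b (Vec.lookup σ i) (toList (relabel xs w′)) ⟩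
    δ (Vec.lookup σ i) b + countLabel b (toList (relabel xs w′))
      ≡⟨ cong₂ _+_ (δ-∉ (lookup-∈ σ i) b∉σ) (relabel-countLabel-outside xs w′ b∉σ (suc-injective fits)) ⟩
    countLabel b (toList xs)          ≡⟨ cong (_+ countLabel b (toList xs)) (δ-∉ x∈σ b∉σ) ⟨
    δ x b + countLabel b (toList xs)  ≡⟨ countLabel-∷ b x (toList xs) ⟨
    countLabel b (x ∷ toList xs) ∎
    where open ≡-Reasoning
  ... | yes _ | [] = contradiction fits 0≢1+n
  ... | no _ | w′ = countLabel-∷-cong b x (relabel-countLabel-outside xs w′ b∉σ fits)

  relabel-countLabel-inside : ∀ {m} i (xs : Vec (Fin n) m) w → Unique (toList σ) → Fits xs w →
                              countLabel (Vec.lookup σ i) (toList (relabel xs w)) ≡ countLabel i w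
  relabel-countLabel-inside i [] [] _ _ = refl
  relabel-countLabel-inside i (x ∷ xs) w σ! fits with x ∈? toList σ | w
  ... | yes _ | j ∷ w′ = begin
    countLabel (Vec.lookup σ i) (Vec.lookup σ j ∷ toList (relabel xs w′))
      ≡⟨ countLabel-∷ (Vec.lookup σ i) (Vec.lookup σ j) (toList (relabel xs w′)) ⟩
    δ (Vec.lookup σ j) (Vec.lookup σ i) + countLabel (Vec.lookup σ i) (toList (relabel xs w′))
      ≡⟨ cong₂ _+_ (𝟙-⇔ (lookup-injective σ σ! j i) (cong (Vec.lookup σ)) (Vec.lookup σ j Fin.≟ Vec.lookup σ i)
                        (j Fin.≟ i))
                   (relabel-countLabel-inside i xs w′ σ! (suc-injective fits)) ⟩
    δ j i + countLabel i w′ ≡⟨ countLabel-∷ i j w′ ⟨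
    countLabel i (j ∷ w′) ∎
    where open ≡-Reasoning
  ... | yes _ | [] = contradiction fits 0≢1+n
  ... | no x∉σ | w′ = trans (countLabel-∷ (Vec.lookup σ i) x (toList (relabel xs w′)))
    (cong₂ _+_ (𝟙-no (x Fin.≟ Vec.lookup σ i) λ { refl → x∉σ (lookup-∈ σ i) })
               (relabel-countLabel-inside i xs w′ σ! fits))

  relabel-isMatching : ∀ r {m} (xs : Vec (Fin n) m) (w : Vec (Fin s) (r * s)) → Unique (toList σ) →
                       IsMatching r xs → IsMatching r w → Fits xs (toList w) → IsMatching r (relabel xs (toList w))
  relabel-isMatching r xs w σ! xs-match w-match fits b with b ∈? toList σ
  ... | no b∉σ = trans (relabel-countLabel-outside xs (toList w) b∉σ fits) (xs-match b)
  ... | yes b∈σ with ∈⇒lookup σ b∈σ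
  ...   | i , refl = trans (relabel-countLabel-inside i xs (toList w) σ! fits) (w-match i)

  relabel-injective : ∀ {m} (xs ys : Vec (Fin n) m) w₁ w₂ → Unique (toList σ) → Fits xs w₁ → Fits ys w₂ →
                      SamePairWordsOn (toList σ) (toList xs) (toList ys) →
                      relabel xs w₁ ≡ relabel ys w₂ → xs ≡ ys × w₁ ≡ w₂
  relabel-injective [] [] [] [] _ _ _ _ _ = refl , refl
  relabel-injective (x ∷ xs) (y ∷ ys) w₁ w₂ σ! fits₁ fits₂ same eq with x ∈? toList σ | w₁ | y ∈? toList σ | w₂
  ... | yes _ | [] | _ | _ = contradiction fits₁ 0≢1+n
  ... | _ | _ | yes _ | [] = contradiction fits₂ 0≢1+n
  ... | yes _ | i ∷ _ | no y∉σ | _ = contradiction (subst (_∈ toList σ) (Vec.∷-injectiveˡ eq) (lookup-∈ σ i)) y∉σ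
  ... | no x∉σ | _ | yes _ | j ∷ _ = contradiction (subst (_∈ toList σ) (sym (Vec.∷-injectiveˡ eq)) (lookup-∈ σ j)) x∉σ
  ... | no _ | w₁′ | no _ | w₂′ with Vec.∷-injective eq
  ...   | refl , eq′
    with relabel-injective xs ys w₁′ w₂′ σ! fits₁ fits₂ (samePairWordsOn-∷⁻ x (toList xs) (toList ys) same) eq′
  ...   | refl , refl = refl , refl
  relabel-injective (x ∷ xs) (y ∷ ys) w₁ w₂ σ! fits₁ fits₂ same eq | yes x∈σ | i ∷ w₁′ | yes y∈σ | j ∷ w₂′
    with lookup-injective σ σ! i j (Vec.∷-injectiveˡ eq) | x Fin.≟ y
  ... | refl | no x≢y = contradiction (begin
        zero ∷ pairWordˡ (toList xs) x y      ≡⟨ pairWordˡ-first x y (toList xs) ⟨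
        pairWordˡ (x ∷ toList xs) x y         ≡⟨ same x∈σ y∈σ x≢y ⟩
        pairWordˡ (y ∷ toList ys) x y         ≡⟨ pairWordˡ-second (toList ys) x≢y ⟩
        suc zero ∷ pairWordˡ (toList ys) x y ∎) λ ()
    where open ≡-Reasoning
  ... | refl | yes refl
    with relabel-injective xs ys w₁′ w₂′ σ! (suc-injective fits₁) (suc-injective fits₂)
           (samePairWordsOn-∷⁻ x (toList xs) (toList ys) same) (Vec.∷-injectiveʳ eq)
  ...   | refl , refl = refl , refl

[m*n]^o≡m^o*n^o : ∀ m n o → (m * n) ^ o ≡ m ^ o * n ^ o
[m*n]^o≡m^o*n^o m n zero = refl
[m*n]^o≡m^o*n^o m n (suc o) = trans (cong (m * n *_) ([m*n]^o≡m^o*n^o m n o)) (regroup m n (m ^ o) (n ^ o))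
  where
  regroup : ∀ m n a b → m * n * (a * b) ≡ m * a * (n * b)
  regroup = solve-∀

n<2^n : ∀ n → n < 2 ^ n
n<2^n zero = s≤s z≤n
n<2^n (suc n) = begin-strict
  suc n           <⟨ s≤s (n<2^n n) ⟩
  suc (2 ^ n)     ≤⟨ +-monoˡ-≤ (2 ^ n) (m^n>0 2 n) ⟩
  2 ^ n + 2 ^ n   ≡⟨ cong (2 ^ n +_) (+-identityʳ (2 ^ n)) ⟨
  2 ^ suc n ∎
  where open ≤-Reasoning

-- (1 + 1/s)^j ≤ s/(s − j), multiplied out.
[1+s]^j*e≤s^[1+j] : ∀ s j e → j + e ≡ s → suc s ^ j * e ≤ s ^ suc j
[1+s]^j*e≤s^[1+j] s zero e refl = ≤-reflexive (trans (*-identityˡ e) (sym (*-identityʳ e)))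
[1+s]^j*e≤s^[1+j] s (suc j) e j+e≡s = begin
  suc s ^ suc j * e       ≡⟨ regroup (suc s) (suc s ^ j) e ⟩
  suc s ^ j * (suc s * e) ≤⟨ *-monoʳ-≤ (suc s ^ j) [1+s]e≤s[1+e] ⟩
  suc s ^ j * (s * suc e) ≡⟨ regroup′ (suc s ^ j) s (suc e) ⟩
  s * (suc s ^ j * suc e) ≤⟨ *-monoʳ-≤ s ([1+s]^j*e≤s^[1+j] s j (suc e) (trans (+-suc j e) j+e≡s)) ⟩
  s * s ^ suc j ∎
  where
  open ≤-Reasoning
  regroup : ∀ a p e → a * p * e ≡ p * (a * e)
  regroup = solve-∀
  regroup′ : ∀ p s f → p * (s * f) ≡ s * (p * f)
  regroup′ = solve-∀
  [1+s]e≤s[1+e] : suc s * e ≤ s * suc e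
  [1+s]e≤s[1+e] = begin
    e + s * e ≡⟨ +-comm e (s * e) ⟩
    s * e + e ≤⟨ +-monoʳ-≤ (s * e) (subst (e ≤_) j+e≡s (m≤n+m e (suc j))) ⟩
    s * e + s ≡⟨ trans (+-comm (s * e) s) (sym (*-suc s e)) ⟩
    s * suc e ∎

[1+s]^j≤2*s^j : ∀ s j e → j + e ≡ s → j ≤ e → suc s ^ j ≤ 2 * s ^ j
[1+s]^j≤2*s^j zero zero zero refl _ = s≤s z≤n
[1+s]^j≤2*s^j s@(suc _) j e j+e≡s j≤e = *-cancelˡ-≤ s (begin
  s * suc s ^ j       ≡⟨ *-comm s (suc s ^ j) ⟩
  suc s ^ j * s       ≤⟨ *-monoʳ-≤ (suc s ^ j) s≤2e ⟩
  suc s ^ j * (2 * e) ≡⟨ regroup (suc s ^ j) e ⟩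
  2 * (suc s ^ j * e) ≤⟨ *-monoʳ-≤ 2 ([1+s]^j*e≤s^[1+j] s j e j+e≡s) ⟩
  2 * (s * s ^ j)     ≡⟨ regroup′ s (s ^ j) ⟩
  s * (2 * s ^ j) ∎)
  where
  open ≤-Reasoning
  regroup : ∀ p e → p * (2 * e) ≡ 2 * (p * e)
  regroup = solve-∀
  regroup′ : ∀ s p → 2 * (s * p) ≡ s * (2 * p)
  regroup′ = solve-∀
  s≤2e : s ≤ 2 * e
  s≤2e = subst (_≤ 2 * e) j+e≡s (≤-trans (+-monoˡ-≤ e j≤e) (≤-reflexive (cong (e +_) (sym (+-identityʳ e)))))

halves : ∀ s → ∃ λ a → s ≡ a + a ⊎ s ≡ suc (a + a)
halves zero = 0 , inj₁ refl
halves (suc s) with halves s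
... | a , inj₁ s≡2a = a , inj₂ (cong suc s≡2a)
... | a , inj₂ s≡1+2a = suc a , inj₁ (cong suc (trans s≡1+2a (sym (+-suc a a))))

[1+s]^s≤8*s^s : ∀ s → suc s ^ s ≤ 8 * s ^ s
[1+s]^s≤8*s^s s with halves s
... | a , inj₁ refl = begin
  suc s ^ (a + a)           ≡⟨ ^-distribˡ-+-* (suc s) a a ⟩
  suc s ^ a * suc s ^ a     ≤⟨ *-mono-≤ half half ⟩
  (2 * s ^ a) * (2 * s ^ a) ≡⟨ regroup (s ^ a) ⟩
  4 * (s ^ a * s ^ a)       ≡⟨ cong (4 *_) (^-distribˡ-+-* s a a) ⟨
  4 * s ^ (a + a)           ≤⟨ *-monoˡ-≤ (s ^ (a + a)) (m≤m+n 4 4) ⟩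
  8 * s ^ (a + a) ∎
  where
  open ≤-Reasoning
  half : suc s ^ a ≤ 2 * s ^ a
  half = [1+s]^j≤2*s^j s a a refl ≤-refl
  regroup : ∀ p → (2 * p) * (2 * p) ≡ 4 * (p * p)
  regroup = solve-∀
... | a , inj₂ refl = begin
  suc s * suc s ^ (a + a)                 ≡⟨ cong (suc s *_) (^-distribˡ-+-* (suc s) a a) ⟩
  suc s * (suc s ^ a * suc s ^ a)         ≤⟨ *-mono-≤ 1+s≤2s (*-mono-≤ half half) ⟩
  (2 * s) * ((2 * s ^ a) * (2 * s ^ a))   ≡⟨ regroup s (s ^ a) ⟩
  8 * (s * (s ^ a * s ^ a))               ≡⟨ cong (λ z → 8 * (s * z)) (^-distribˡ-+-* s a a) ⟨
  8 * s ^ suc (a + a) ∎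
  where
  open ≤-Reasoning
  half : suc s ^ a ≤ 2 * s ^ a
  half = [1+s]^j≤2*s^j s a (suc a) (+-suc a a) (n≤1+n a)
  1+s≤2s : suc s ≤ 2 * s
  1+s≤2s = subst (_≤ 2 * s) (+-comm s 1) (+-monoʳ-≤ s (≤-trans (s≤s z≤n) (≤-reflexive (sym (+-identityʳ s)))))
  regroup : ∀ s p → (2 * s) * ((2 * p) * (2 * p)) ≡ 8 * (s * (p * p))
  regroup = solve-∀

s^s≤8^s*s! : ∀ s → s ^ s ≤ 8 ^ s * s !
s^s≤8^s*s! zero = s≤s z≤n
s^s≤8^s*s! (suc s) = begin
  suc s * suc s ^ s           ≤⟨ *-monoʳ-≤ (suc s) ([1+s]^s≤8*s^s s) ⟩
  suc s * (8 * s ^ s)         ≤⟨ *-monoʳ-≤ (suc s) (*-monoʳ-≤ 8 (s^s≤8^s*s! s)) ⟩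
  suc s * (8 * (8 ^ s * s !)) ≡⟨ regroup (suc s) (8 ^ s) (s !) ⟩
  8 ^ suc s * suc s ! ∎
  where
  open ≤-Reasoning
  regroup : ∀ a b c → a * (8 * (b * c)) ≡ 8 * b * (a * c)
  regroup = solve-∀

module _ {P : ℕ → Set} (P? : Decidable P) where

  private
    searchFrom : ∀ d j → (∀ {t} → t < j → ¬ P t) → P (d + j) → ∃ λ s → P s × (∀ {t} → P t → s ≤ t)
    searchFrom zero j below p = j , p , λ pt → ≮⇒≥ (λ t<j → below t<j pt)
    searchFrom (suc d) j below p with P? j
    ... | yes pj = j , pj , λ pt → ≮⇒≥ (λ t<j → below t<j pt)
    ... | no ¬pj = searchFrom d (suc j) below′ (subst P (sym (+-suc d j)) p)
      where
      below′ : ∀ {t} → t < suc j → ¬ P t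
      below′ t<1+j with m<1+n⇒m<n∨m≡n t<1+j
      ... | inj₁ t<j = below t<j
      ... | inj₂ refl = ¬pj

  minimalWitness : ∀ {m} → P m → ∃ λ s → P s × (∀ {t} → P t → s ≤ t)
  minimalWitness {m} p = searchFrom m 0 (λ ()) (subst P (sym (+-identityʳ m)) p)

-- 16 = 2 · 8: the 8 pays for s^s ≤ 8^s s!, the 2 for k + 1 ≤ 2^(rs).
[1+k]*n^s≤[s!]^r : ∀ r k n s → 1 ≤ r → k ^ r < n → 16 ^ r * n < s ^ r → suc k * n ^ s ≤ (s !) ^ r
[1+k]*n^s≤[s!]^r r@(suc _) k n s _ k^r<n 16^r*n<s^r = ≤-trans (*-monoˡ-≤ (n ^ s) 1+k≤2^[r*s]) 2^[r*s]*n^s≤[s!]^r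
  where
  open ≤-Reasoning
  k<s : k < s
  k<s = ≮⇒≥ λ s<1+k → <-irrefl refl (<-≤-trans 16^r*n<s^r (begin
    s ^ r      ≤⟨ ^-monoˡ-≤ r (s≤s⁻¹ s<1+k) ⟩
    k ^ r      ≤⟨ <⇒≤ k^r<n ⟩
    n          ≤⟨ m≤n*m n (16 ^ r) {{m^n≢0 16 r}} ⟩
    16 ^ r * n ∎))
  1+k≤2^[r*s] : suc k ≤ 2 ^ (r * s)
  1+k≤2^[r*s] = ≤-trans k<s (≤-trans (<⇒≤ (n<2^n s)) (^-monoʳ-≤ 2 (m≤n*m s r)))
  2^[r*s]*n^s≤[s!]^r : 2 ^ (r * s) * n ^ s ≤ (s !) ^ r
  2^[r*s]*n^s≤[s!]^r = *-cancelˡ-≤ (8 ^ (r * s)) {{m^n≢0 8 (r * s)}} (begin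
    8 ^ (r * s) * (2 ^ (r * s) * n ^ s) ≡⟨ regroup (8 ^ (r * s)) (2 ^ (r * s)) (n ^ s) ⟩
    (2 ^ (r * s) * 8 ^ (r * s)) * n ^ s ≡⟨ cong (_* n ^ s) ([m*n]^o≡m^o*n^o 2 8 (r * s)) ⟨
    16 ^ (r * s) * n ^ s                ≡⟨ cong (_* n ^ s) (^-*-assoc 16 r s) ⟨
    (16 ^ r) ^ s * n ^ s                ≡⟨ [m*n]^o≡m^o*n^o (16 ^ r) n s ⟨
    (16 ^ r * n) ^ s                    ≤⟨ ^-monoˡ-≤ s (<⇒≤ 16^r*n<s^r) ⟩
    (s ^ r) ^ s                         ≡⟨ trans (^-*-assoc s r s) (cong (s ^_) (*-comm r s)) ⟩
    s ^ (s * r)                         ≡⟨ ^-*-assoc s s r ⟨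
    (s ^ s) ^ r                         ≤⟨ ^-monoˡ-≤ r (s^s≤8^s*s! s) ⟩
    (8 ^ s * s !) ^ r                   ≡⟨ [m*n]^o≡m^o*n^o (8 ^ s) (s !) r ⟩
    (8 ^ s) ^ r * (s !) ^ r             ≡⟨ cong (_* (s !) ^ r) (trans (^-*-assoc 8 s r) (cong (8 ^_) (*-comm s r))) ⟩
    8 ^ (r * s) * (s !) ^ r ∎)
    where
    regroup : ∀ a b c → a * (b * c) ≡ b * a * c
    regroup = solve-∀


-- Counting matchings with a large clique

module Counting (r : ℕ) (P : Vec (Fin 2) (r * 2)) (n s : ℕ) where

  open Relabel

  matchings : List (Vec (Fin n) (r * n))
  matchings = filter (isMatching? r) (allVecs n (r * n))

  witnesses : List (Vec (Fin n) (r * n) × Vec (Fin n) s)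
  witnesses = filter (λ (v , σ) → orderedClique? r P v σ) (cartesianProduct matchings (allVecs n s))

  witnessedMatchings : List (Vec (Fin n) (r * n))
  witnessedMatchings = map proj₁ witnesses

  ∈-witnesses⁺ : ∀ {v σ} → IsMatching r v → OrderedClique r P v σ → (v , σ) ∈ witnesses
  ∈-witnesses⁺ {v} {σ} v-match σ-clique = ∈-filter⁺ (λ (v , σ) → orderedClique? r P v σ)
    (∈-cartesianProduct⁺ (∈-filter⁺ (isMatching? r) (∈-allVecs v) v-match) (∈-allVecs σ)) σ-clique

  ∈-witnesses⁻ : ∀ {v σ} → (v , σ) ∈ witnesses → IsMatching r v × OrderedClique r P v σ
  ∈-witnesses⁻ {v} vσ∈
    with ∈-filter⁻ (λ (v , σ) → orderedClique? r P v σ) {xs = cartesianProduct matchings (allVecs n s)} vσ∈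
  ... | vσ∈′ , σ-clique = v-match , σ-clique
    where
    v∈ : v ∈ matchings
    v∈ = proj₁ (∈-cartesianProduct⁻ matchings (allVecs n s) vσ∈′)
    v-match : IsMatching r v
    v-match = proj₂ (∈-filter⁻ (isMatching? r) {xs = allVecs n (r * n)} v∈)

  witness-fits : ∀ {v : Vec (Fin n) (r * n)} {σ : Vec (Fin n) s} → IsMatching r v → OrderedClique r P v σ →
                 (w : Vec (Fin s) (r * s)) → Fits σ v (toList w)
  witness-fits {v} {σ} v-match σ-clique w = begin
    length (toList w)              ≡⟨ Vec.length-toList w ⟩
    r * s                          ≡⟨ *-comm r s ⟩
    s * r                          ≡⟨ cong (_* r) (Vec.length-toList σ) ⟨
    length (toList σ) * r
      ≡⟨ labelsIn-matching (toList σ) (toList v) (orderedClique⇒unique r σ-clique) v-match ⟨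
    labelsIn (toList σ) (toList v) ∎
    where open ≡-Reasoning

  relabelWitness : (Vec (Fin n) (r * n) × Vec (Fin n) s) × Vec (Fin s) (r * s) → Vec (Fin n) (r * n) × Vec (Fin n) s
  relabelWitness ((v , σ) , w) = relabel σ v (toList w) , σ

  length-witnesses : length witnesses * (s !) ^ r ≤ numMatchings r n * n ^ s
  length-witnesses = subst₂ _≤_ length-domain length-codomain (length-≤-injectiveOn relabelWitness domain⁺ maps-into injective)
    where
    open ≡-Reasoning
    domain : List ((Vec (Fin n) (r * n) × Vec (Fin n) s) × Vec (Fin s) (r * s))
    domain = cartesianProduct witnesses (blockMatchings r s)
    codomain : List (Vec (Fin n) (r * n) × Vec (Fin n) s)
    codomain = cartesianProduct matchings (allVecs n s)

    length-domain : length domain ≡ length witnesses * (s !) ^ r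
    length-domain = begin
      length domain                                   ≡⟨ length-cartesianProductWith _,_ witnesses (blockMatchings r s) ⟩
      length witnesses * length (blockMatchings r s)  ≡⟨ cong (length witnesses *_) (length-blockMatchings r s) ⟩
      length witnesses * (s !) ^ r ∎

    length-codomain : length codomain ≡ numMatchings r n * n ^ s
    length-codomain = begin
      length codomain                            ≡⟨ length-cartesianProductWith _,_ matchings (allVecs n s) ⟩
      numMatchings r n * length (allVecs n s)    ≡⟨ cong (numMatchings r n *_) (length-allVecs n s) ⟩
      numMatchings r n * n ^ s ∎

    domain⁺ : Unique domain
    domain⁺ = Unique.cartesianProduct⁺
      (Unique.filter⁺ _ (Unique.cartesianProduct⁺ (Unique.filter⁺ (isMatching? r) (allVecs⁺ n (r * n))) (allVecs⁺ n s)))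
      (blockMatchings⁺ r s)

    ∈-domain⁻ : ∀ {v σ w} → ((v , σ) , w) ∈ domain → IsMatching r v × OrderedClique r P v σ × w ∈ blockMatchings r s
    ∈-domain⁻ x∈ with ∈-cartesianProduct⁻ witnesses (blockMatchings r s) x∈
    ... | vσ∈ , w∈ = proj₁ (∈-witnesses⁻ vσ∈) , proj₂ (∈-witnesses⁻ vσ∈) , w∈

    maps-into : ∀ {x} → x ∈ domain → relabelWitness x ∈ codomain
    maps-into {(v , σ) , w} x∈ with ∈-domain⁻ x∈
    ... | v-match , σ-clique , w∈ = ∈-cartesianProduct⁺
      (∈-filter⁺ (isMatching? r) (∈-allVecs _)
        (relabel-isMatching σ r v w (orderedClique⇒unique r σ-clique) v-match (blockMatching⇒isMatching r w∈)
          (witness-fits v-match σ-clique w)))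
      (∈-allVecs σ)

    injective : ∀ {x y} → x ∈ domain → y ∈ domain → relabelWitness x ≡ relabelWitness y → x ≡ y
    injective {(v₁ , σ) , w₁} {(v₂ , _) , w₂} x∈ y∈ eq with cong proj₂ eq
    ... | refl with ∈-domain⁻ x∈ | ∈-domain⁻ y∈
    ...   | v₁-match , clique₁ , _ | v₂-match , clique₂ , _
      with relabel-injective σ v₁ v₂ (toList w₁) (toList w₂) (orderedClique⇒unique r clique₁)
             (witness-fits v₁-match clique₁ w₁) (witness-fits v₂-match clique₂ w₂)
             (orderedClique⇒samePairWords r clique₁ clique₂) (cong proj₁ eq)
    ...   | refl , w₁≡w₂ = cong ((v₁ , σ) ,_) (trans (sym (cast-is-id refl w₁)) (Vec.toList-injective refl w₁ w₂ w₁≡w₂))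

  bad⇒∈witnessedMatchings : ∀ {C} → 1 ≤ r → (∀ {t} → C ^ r * n < t ^ r → s ≤ t) →
                            ∀ v → IsMatching r v → Bad r C P v → v ∈ witnessedMatchings
  bad⇒∈witnessedMatchings 1≤r minimal v v-match (S , clique , big) =
    let σ , σ-clique = clique⇒orderedClique r P v S occurs clique s (minimal big)
    in ∈-map⁺ proj₁ (∈-witnesses⁺ v-match σ-clique)
    where
    occurs : ∀ a → a ∈ toList v
    occurs a = countLabel>0⇒∈ (subst (0 <_) (sym (v-match a)) 1≤r)

  length-witnessedMatchings : ∀ k → 0 < n → suc k * n ^ s ≤ (s !) ^ r →
                              length witnessedMatchings * suc k ≤ numMatchings r n
  length-witnessedMatchings k n>0 bound = *-cancelʳ-≤ _ _ (n ^ s) {{m^n≢0 n s {{>-nonZero n>0}}}} (begin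
    length witnessedMatchings * suc k * n ^ s ≡⟨ cong (λ l → l * suc k * n ^ s) (length-map proj₁ witnesses) ⟩
    length witnesses * suc k * n ^ s          ≡⟨ *-assoc (length witnesses) (suc k) (n ^ s) ⟩
    length witnesses * (suc k * n ^ s)        ≤⟨ *-monoʳ-≤ (length witnesses) bound ⟩
    length witnesses * (s !) ^ r              ≤⟨ length-witnesses ⟩
    numMatchings r n * n ^ s ∎)
    where open ≤-Reasoning

lemma3p1 : (r : ℕ) → 2 ≤ r →
    Σ ℕ λ C → 1 ≤ C ×
      ((P : Vec (Fin 2) (r * 2)) → IsMatching r P → Collectable r P →
        (k : ℕ) → Σ ℕ λ N → (n : ℕ) → N ≤ n →
          Σ (List (Vec (Fin n) (r * n))) λ L →
            ((v : Vec (Fin n) (r * n)) → IsMatching r v → Bad r C P v → v ∈ L) ×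
            (length L * suc k ≤ numMatchings r n))
lemma3p1 r 2≤r = 16 , s≤s z≤n , λ P _ _ k → suc (k ^ r) , λ n k^r<n →
  let s , 16^r*n<s^r , minimal = leastCliqueSize n
      open Counting r P n s
  in witnessedMatchings
   , bad⇒∈witnessedMatchings 1≤r minimal
   , length-witnessedMatchings k (≤-trans (s≤s z≤n) k^r<n) ([1+k]*n^s≤[s!]^r r k n s 1≤r k^r<n 16^r*n<s^r)
  where
  1≤r : 1 ≤ r
  1≤r = ≤-trans (s≤s z≤n) 2≤r
  leastCliqueSize : ∀ n → ∃ λ s → 16 ^ r * n < s ^ r × (∀ {t} → 16 ^ r * n < t ^ r → s ≤ t)
  leastCliqueSize n = minimalWitness (λ t → X <? t ^ r)
    (<-≤-trans (n<1+n X) (≤-trans (≤-reflexive (sym (^-identityʳ (suc X)))) (^-monoʳ-≤ (suc X) 1≤r)))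
    where
    X : ℕ
    X = 16 ^ r * n
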